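{- Let $m>1$ be an integer, let $G$ and $H$ be non-trivial finite groups, and let $x\in G^\times$, $y\in H^\times$. Then $\mathscr{I}_m(x,G)\simeq\mathscr{I}_m(y,H)$ if and only if either $o(x)=2=o(y)$ or $o(x)\neq2\neq o(y)$.
   Context: For a finite group $G$ with identity $e$, $G^\times=G\setminus\{e\}$ and $o(x)$ denotes the order of $x$. For $z\in G^\times$ and $1\leqslant k<l\leqslant m+1$, $\mathbf{z}_{[k,l)}\in G^m$ has $j$-th coordinate $z$ for $k\leqslant j<l$ and $e$ otherwise; $\mathcal{S}$ is the set of all such $\mathbf{z}_{[k,l)}$, and $\mathscr{G}_m(G)=Cay(G^m,\mathcal{S})$ is the graph on $G^m$ with $\mathbf{g}\sim\mathbf{h}$ iff $\mathbf{h}\mathbf{g}^{ -1}\in\mathcal{S}$. For $x\in G^\times$, $I_m(x)=\{\mathbf{x}_{[k,l)}:1\leqslant k<l\leqslant m+1\}\cup\{(\mathbf{x}^{ -1})_{[k,l)}:1\leqslant k<l\leqslant m+1\}$ and $\mathscr{I}_m(x,G)$ is the subgraph of $\mathscr{G}_m(G)$ induced on $I_m(x)$; similarly for $H$. -}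

module Defs where

open import Level using (Level; _⊔_)
open import Algebra.Bundles using (Group)
open import Data.Nat using (ℕ; zero; suc; _≤_; _<_; _≤ᵇ_; _<ᵇ_)
open import Data.Fin using (Fin; toℕ)
open import Data.Bool using (Bool; true; false; if_then_else_; _∧_)
open import Data.Product using (Σ; ∃; _×_; _,_; proj₁)
open import Data.Sum using (_⊎_)
open import Relation.Nullary using (¬_)
open import Function.Bundles using (Inverse)
import Relation.Binary.PropositionalEquality as ≡

module _ {c ℓ : Level} (G : Group c ℓ) where
  open Group G

  pow : Carrier → ℕ → Carrier
  pow x zero    = ε
  pow x (suc n) = x ∙ pow x n

  IsOrder : Carrier → ℕ → Set ℓ
  IsOrder x n = (0 < n) × (pow x n ≈ ε)
              × (∀ k → 0 < k → k < n → ¬ (pow x k ≈ ε))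

  IsFinite : Set (c ⊔ ℓ)
  IsFinite = ∃ λ n → Inverse setoid (≡.setoid (Fin n))

  NonTrivial : Set (c ⊔ ℓ)
  NonTrivial = ∃ λ g → ¬ (g ≈ ε)

  module _ (m : ℕ) where
    -- elements of G^m, coordinates indexed by Fin m (0-based: index i is
    -- the (toℕ i + 1)-th coordinate of the paper)
    Tuple : Set c
    Tuple = Fin m → Carrier

    _≈ₜ_ : Tuple → Tuple → Set ℓ
    u ≈ₜ v = ∀ i → u i ≈ v i

    ValidRange : ℕ → ℕ → Set
    ValidRange k l = (1 ≤ k) × (k < l) × (l ≤ suc m)

    inBlock : ℕ → ℕ → Fin m → Bool
    inBlock k l i = (k ≤ᵇ suc (toℕ i)) ∧ (suc (toℕ i) <ᵇ l)

    block : Carrier → ℕ → ℕ → Tuple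
    block z k l i = if inBlock k l i then z else ε

    InS : Tuple → Set (c ⊔ ℓ)
    InS v = ∃ λ z → ¬ (z ≈ ε) × ∃ λ k → ∃ λ l → ValidRange k l × (v ≈ₜ block z k l)

    Adj : Tuple → Tuple → Set (c ⊔ ℓ)
    Adj g h = InS (λ i → h i ∙ (g i) ⁻¹)

    InI : Carrier → Tuple → Set ℓ
    InI x v = ∃ λ k → ∃ λ l → ValidRange k l
              × ((v ≈ₜ block x k l) ⊎ (v ≈ₜ block (x ⁻¹) k l))

    VertI : Carrier → Set (c ⊔ ℓ)
    VertI x = Σ Tuple (InI x)

record IsoI {c ℓ c' ℓ' : Level} (m : ℕ)
            (G : Group c ℓ) (x : Group.Carrier G)
            (H : Group c' ℓ') (y : Group.Carrier H) : Set (c ⊔ ℓ ⊔ c' ⊔ ℓ') where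
  field
    to   : VertI G m x → VertI H m y
    from : VertI H m y → VertI G m x
    to-cong   : ∀ {u v} → _≈ₜ_ G m (proj₁ u) (proj₁ v) → _≈ₜ_ H m (proj₁ (to u)) (proj₁ (to v))
    from-cong : ∀ {u v} → _≈ₜ_ H m (proj₁ u) (proj₁ v) → _≈ₜ_ G m (proj₁ (from u)) (proj₁ (from v))
    from∘to : ∀ u → _≈ₜ_ G m (proj₁ (from (to u))) (proj₁ u)
    to∘from : ∀ v → _≈ₜ_ H m (proj₁ (to (from v))) (proj₁ v)
    adj-to   : ∀ u v → Adj G m (proj₁ u) (proj₁ v) → Adj H m (proj₁ (to u)) (proj₁ (to v))
    adj-from : ∀ u v → Adj H m (proj₁ (to u)) (proj₁ (to v)) → Adj G m (proj₁ u) (proj₁ v)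

-- Every vertex of I_m(x, G) is a block c_[k,l) with c ∈ {x, x⁻¹}. Coordinatewise, the
-- quotient of two blocks takes values among e, c', c⁻¹, c' c⁻¹, and which of these coincide is decided
-- by the two relations c' = c and c' = c⁻¹; for x ≠ e these are governed by whether x⁻¹ = x, that is,
-- o(x) = 2. So when o(x) = 2 ⇔ o(y) = 2, keeping signs and ranges is a graph isomorphism.
-- Conversely, if x⁻¹ = x then blocks multiply like indicator vectors mod 2, so whenever
-- v u⁻¹ = z_[p,q) the block x_[p,q) is a common neighbour of u and v: every edge lies in a
-- triangle. If y⁻¹ ≠ y, the edge y_[1,2) ~ y⁻¹_[1,2) lies in no triangle.
module Submission where

open import Level using (Level; _⊔_)
open import Algebra.Bundles using (Group)
open import Data.Bool using (Bool; true; false; T; if_then_else_; _∧_; _xor_)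
open import Data.Bool.Properties using (T-∧; not-involutive; xor-comm)
open import Data.Empty using (⊥; ⊥-elim)
open import Data.Fin using (Fin; zero; suc; toℕ; fromℕ<)
open import Data.Fin.Properties using (toℕ-fromℕ<; inj⇒≟)
open import Data.Nat using (ℕ; zero; suc; _<_; _≤ᵇ_; _<ᵇ_; z≤n; s≤s)
open import Data.Nat.Properties using (≤⇒≤ᵇ; <⇒<ᵇ; ≤-refl; ≤-trans; ≤-pred)
open import Data.Product using (∃; _×_; _,_; proj₁; proj₂)
open import Data.Sum using (_⊎_; inj₁; inj₂)
open import Function.Bundles using (Equivalence; _⇔_; mk⇔)
open import Function.Properties.Inverse using (Inverse⇒Injection)
open import Relation.Binary.PropositionalEquality as ≡ using (_≡_)
open import Relation.Nullary using (¬_; Dec; yes; no)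
import Algebra.Properties.Group as GroupProperties

open import Defs

xor-cancelˡ : ∀ a b → a xor (a xor b) ≡ b
xor-cancelˡ false b = ≡.refl
xor-cancelˡ true  b = not-involutive b

module Coordinates {c ℓ : Level} (G : Group c ℓ) where
  open Group G
  open GroupProperties G

  _^±_ : Carrier → Bool → Carrier
  a ^± true  = a
  a ^± false = a ⁻¹

  atom : Carrier → Bool → Carrier
  atom a β = if β then a else ε

  quotient : Carrier → Carrier → Bool → Bool → Carrier
  quotient a a' false β'    = atom a' β'
  quotient a a' true  false = a ⁻¹
  quotient a a' true  true  = a' ∙ a ⁻¹

  atom-quotient : ∀ a a' β β' → atom a' β' ∙ atom a β ⁻¹ ≈ quotient a a' β β'
  atom-quotient a a' false β'    = trans (∙-congˡ ε⁻¹≈ε) (identityʳ _)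
  atom-quotient a a' true  false = identityˡ _
  atom-quotient a a' true  true  = refl

  atom-quotient-selfInverse : ∀ {a} → a ⁻¹ ≈ a → ∀ β β' → atom a β' ∙ atom a β ⁻¹ ≈ atom a (β xor β')
  atom-quotient-selfInverse {a} _    false β'    = atom-quotient a a false β'
  atom-quotient-selfInverse     a⁻¹≈a true  false = trans (identityˡ _) a⁻¹≈a
  atom-quotient-selfInverse {a} _    true  true  = inverseʳ a

  atom-injective : ∀ {a b} → ¬ a ≈ ε → ¬ b ≈ ε → ∀ β γ → atom a β ≈ atom b γ → β ≡ γ
  atom-injective a≉ε b≉ε false false e = ≡.refl
  atom-injective a≉ε b≉ε false true  e = ⊥-elim (b≉ε (sym e))
  atom-injective a≉ε b≉ε true  false e = ⊥-elim (a≉ε e)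
  atom-injective a≉ε b≉ε true  true  e = ≡.refl

  ≈atom⇒≈ : ∀ {u a} β → u ≈ atom a β → ¬ u ≈ ε → u ≈ a
  ≈atom⇒≈ true  u≈a _   = u≈a
  ≈atom⇒≈ false u≈ε u≉ε = ⊥-elim (u≉ε u≈ε)

  quotient-diagonal : ∀ a a' β → quotient a a' β β ≈ atom (a' ∙ a ⁻¹) β
  quotient-diagonal a a' false = refl
  quotient-diagonal a a' true  = refl

  atom-cong : ∀ {a b} β → a ≈ b → atom a β ≈ atom b β
  atom-cong false _   = refl
  atom-cong true  a≈b = a≈b

  -- Over a self-inverse a, quotients of atoms are atoms of the symmetric difference; so the
  -- block witnessing an edge is itself adjacent to both endpoints.
  selfInverse-triangle : ∀ {a z} → ¬ a ≈ ε → ¬ z ≈ ε → a ⁻¹ ≈ a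
    → ∀ β β' γ → atom a β' ∙ atom a β ⁻¹ ≈ atom z γ
    → atom a γ ∙ atom a β ⁻¹ ≈ atom a β' × atom a γ ∙ atom a β' ⁻¹ ≈ atom a β
  selfInverse-triangle {a} a≉ε z≉ε a⁻¹≈a β β' γ e
    with atom-injective a≉ε z≉ε (β xor β') γ (trans (sym (atom-quotient-selfInverse a⁻¹≈a β β')) e)
  ... | ≡.refl =
      trans (atom-quotient-selfInverse a⁻¹≈a β (β xor β')) (reflexive (≡.cong (atom a) (xor-cancelˡ β β')))
    , trans (atom-quotient-selfInverse a⁻¹≈a β' (β xor β'))
            (reflexive (≡.cong (atom a) (≡.trans (≡.cong (β' xor_) (xor-comm β β')) (xor-cancelˡ β' β))))

  ⁻¹≈ε⇒≈ε : ∀ {a} → a ⁻¹ ≈ ε → a ≈ ε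
  ⁻¹≈ε⇒≈ε a⁻¹≈ε = ⁻¹-injective (trans a⁻¹≈ε (sym ε⁻¹≈ε))

  ^±≉ε : ∀ {a} s → ¬ a ≈ ε → ¬ a ^± s ≈ ε
  ^±≉ε true  a≉ε = a≉ε
  ^±≉ε false a≉ε = λ a⁻¹≈ε → a≉ε (⁻¹≈ε⇒≈ε a⁻¹≈ε)

  square≈ε⇒selfInverse : ∀ {a} → a ∙ a ≈ ε → a ⁻¹ ≈ a
  square≈ε⇒selfInverse {a} a∙a≈ε = sym (inverseˡ-unique a a a∙a≈ε)

  ^±-selfInverse : ∀ {a} → a ⁻¹ ≈ a → ∀ s → a ^± s ≈ a
  ^±-selfInverse _     true  = refl
  ^±-selfInverse a⁻¹≈a false = a⁻¹≈a

  isOrder2⇔selfInverse : ∀ {a} → ¬ a ≈ ε → IsOrder G a 2 ⇔ a ⁻¹ ≈ a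
  isOrder2⇔selfInverse {a} a≉ε = mk⇔
    (λ (_ , a∙a∙ε≈ε , _) → square≈ε⇒selfInverse (trans (∙-congˡ (sym (identityʳ a))) a∙a∙ε≈ε))
    (λ a⁻¹≈a → s≤s z≤n , trans (∙-congˡ (trans (identityʳ a) (sym a⁻¹≈a))) (inverseʳ a) , noSmallerPower)
    where
      noSmallerPower : ∀ k → 0 < k → k < 2 → ¬ pow G a k ≈ ε
      noSmallerPower (suc zero)    _ _ a∙ε≈ε = a≉ε (trans (sym (identityʳ a)) a∙ε≈ε)
      noSmallerPower (suc (suc k)) _ (s≤s (s≤s ()))

  selfInverse? : IsFinite G → ∀ a → Dec (a ⁻¹ ≈ a)
  selfInverse? (_ , G↔Fin) a = inj⇒≟ (Inverse⇒Injection G↔Fin) (a ⁻¹) a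

module Blocks {c ℓ : Level} (G : Group c ℓ) (m : ℕ) where
  open Group G
  open Coordinates G

  inBlock-witness : ∀ {k l} → ValidRange G m k l → ∃ λ i → T (inBlock G m k l i)
  inBlock-witness {suc k} {l} (_ , k<l , l≤1+m) = i , inBlock-i
    where
      k<m : k < m
      k<m = ≤-pred (≤-trans k<l l≤1+m)
      i = fromℕ< k<m
      inBlock-i : T ((suc k ≤ᵇ suc (toℕ i)) ∧ (suc (toℕ i) <ᵇ l))
      inBlock-i rewrite toℕ-fromℕ< k<m = Equivalence.from T-∧ (≤⇒≤ᵇ (≤-refl {suc k}) , <⇒<ᵇ k<l)

  atom-T : ∀ {a β} → T β → atom a β ≈ a
  atom-T {β = true} _ = refl

  InS-resp : ∀ {u v} → _≈ₜ_ G m u v → InS G m u → InS G m v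
  InS-resp u≈v (z , z≉ε , k , l , vr , u≈z) = z , z≉ε , k , l , vr , λ i → trans (sym (u≈v i)) (u≈z i)

  Adj-resp : ∀ {g g' h h'} → _≈ₜ_ G m g g' → _≈ₜ_ G m h h' → Adj G m g h → Adj G m g' h'
  Adj-resp g≈g' h≈h' = InS-resp λ i → ∙-cong (h≈h' i) (⁻¹-cong (g≈g' i))

  InS-support : ∀ {v} → InS G m v → ∃ λ i → ¬ v i ≈ ε
  InS-support (z , z≉ε , k , l , vr , v≈z) =
    let i , Tᵢ = inBlock-witness vr
    in  i , λ vᵢ≈ε → z≉ε (trans (sym (atom-T Tᵢ)) (trans (sym (v≈z i)) vᵢ≈ε))

  InS-constant : ∀ {v} → InS G m v → ∀ {i j} → ¬ v i ≈ ε → ¬ v j ≈ ε → v i ≈ v j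
  InS-constant (z , _ , k , l , _ , v≈z) {i} {j} vᵢ≉ε vⱼ≉ε =
    trans (≈atom⇒≈ (inBlock G m k l i) (v≈z i) vᵢ≉ε) (sym (≈atom⇒≈ (inBlock G m k l j) (v≈z j) vⱼ≉ε))

  vertex : ∀ a s {k l} → ValidRange G m k l → VertI G m a
  vertex a s {k} {l} vr = block G m (a ^± s) k l , k , l , vr , signed s
    where
      signed : ∀ s → _≈ₜ_ G m (block G m (a ^± s) k l) (block G m a k l)
                   ⊎ _≈ₜ_ G m (block G m (a ^± s) k l) (block G m (a ⁻¹) k l)
      signed true  = inj₁ λ _ → refl
      signed false = inj₂ λ _ → refl

  selfInverse-edge-triangle : ∀ {a k l k' l'} → ¬ a ≈ ε → a ⁻¹ ≈ a
    → ValidRange G m k l → ValidRange G m k' l'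
    → Adj G m (block G m a k l) (block G m a k' l')
    → ∃ λ p → ∃ λ q → ValidRange G m p q
        × Adj G m (block G m a k l) (block G m a p q) × Adj G m (block G m a k' l') (block G m a p q)
  selfInverse-edge-triangle {a} {k} {l} {k'} {l'} a≉ε a⁻¹≈a vr vr' (z , z≉ε , p , q , vr″ , quotient≈z) =
    p , q , vr″ , (a , a≉ε , k' , l' , vr' , λ i → proj₁ (triangle i))
                , (a , a≉ε , k , l , vr , λ i → proj₂ (triangle i))
    where
      triangle : ∀ i → _
      triangle i = selfInverse-triangle a≉ε z≉ε a⁻¹≈a
        (inBlock G m k l i) (inBlock G m k' l' i) (inBlock G m p q i) (quotient≈z i)

  module _ {a : Carrier} where
    sign : VertI G m a → Bool
    sign (_ , _ , _ , _ , inj₁ _) = true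
    sign (_ , _ , _ , _ , inj₂ _) = false

    lower upper : VertI G m a → ℕ
    lower u = proj₁ (proj₂ u)
    upper u = proj₁ (proj₂ (proj₂ u))

    range : (u : VertI G m a) → ValidRange G m (lower u) (upper u)
    range u = proj₁ (proj₂ (proj₂ (proj₂ u)))

    vertex≈block : (u : VertI G m a)
      → _≈ₜ_ G m (proj₁ u) (block G m (a ^± sign u) (lower u) (upper u))
    vertex≈block (_ , _ , _ , _ , inj₁ t≈block) = t≈block
    vertex≈block (_ , _ , _ , _ , inj₂ t≈block) = t≈block

module Transfer {c ℓ c' ℓ' : Level} (G : Group c ℓ) (H : Group c' ℓ') where
  module G where
    open Group G public
    open GroupProperties G public
    open Coordinates G public
  module H where
    open Group H public
    open GroupProperties H public
    open Coordinates H public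

  quotient-transfer : ∀ {a a' b b'} → ¬ a G.≈ G.ε → ¬ a' G.≈ G.ε
    → (a' G.≈ a → b' H.≈ b) → (a' G.≈ a G.⁻¹ → b' H.≈ b H.⁻¹)
    → ∀ β₁ β₁' β₂ β₂' → G.quotient a a' β₁ β₁' G.≈ G.quotient a a' β₂ β₂'
    → H.quotient b b' β₁ β₁' H.≈ H.quotient b b' β₂ β₂'
  quotient-transfer a≉ε a'≉ε equal inverse = q
    where
      q : ∀ β₁ β₁' β₂ β₂' → _ → _
      q false false false false e = H.refl
      q false false false true  e = ⊥-elim (a'≉ε (G.sym e))
      q false false true  false e = ⊥-elim (a≉ε (G.⁻¹≈ε⇒≈ε (G.sym e)))
      q false false true  true  e = H.sym (H.x≈y⇒x∙y⁻¹≈ε (equal (G.x∙y⁻¹≈ε⇒x≈y _ _ (G.sym e))))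
      q false true  false false e = ⊥-elim (a'≉ε e)
      q false true  false true  e = H.refl
      q false true  true  false e = inverse e
      q false true  true  true  e = ⊥-elim (a≉ε (G.⁻¹≈ε⇒≈ε (G.identityʳ-unique _ _ (G.sym e))))
      q true  false false false e = ⊥-elim (a≉ε (G.⁻¹≈ε⇒≈ε e))
      q true  false false true  e = H.sym (inverse (G.sym e))
      q true  false true  false e = H.refl
      q true  false true  true  e = ⊥-elim (a'≉ε (G.identityˡ-unique _ _ (G.sym e)))
      q true  true  false false e = H.x≈y⇒x∙y⁻¹≈ε (equal (G.x∙y⁻¹≈ε⇒x≈y _ _ e))
      q true  true  false true  e = ⊥-elim (a≉ε (G.⁻¹≈ε⇒≈ε (G.identityʳ-unique _ _ e)))
      q true  true  true  false e = ⊥-elim (a'≉ε (G.identityˡ-unique _ _ e))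
      q true  true  true  true  e = H.refl

  atom-transfer : ∀ {a a' b b'} → ¬ a G.≈ G.ε → ¬ a' G.≈ G.ε → (a G.≈ a' → b H.≈ b')
    → ∀ β β' → G.atom a β G.≈ G.atom a' β' → H.atom b β H.≈ H.atom b' β'
  atom-transfer a≉ε a'≉ε equal false false e = H.refl
  atom-transfer a≉ε a'≉ε equal false true  e = ⊥-elim (a'≉ε (G.sym e))
  atom-transfer a≉ε a'≉ε equal true  false e = ⊥-elim (a≉ε e)
  atom-transfer a≉ε a'≉ε equal true  true  e = equal e

  module _ {x : G.Carrier} {y : H.Carrier} (selfInverse⇒ : x G.⁻¹ G.≈ x → y H.⁻¹ H.≈ y) where

    ^±-equal : ∀ s s' → x G.^± s' G.≈ x G.^± s → y H.^± s' H.≈ y H.^± s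
    ^±-equal true  true  e = H.refl
    ^±-equal true  false e = selfInverse⇒ e
    ^±-equal false true  e = H.sym (selfInverse⇒ (G.sym e))
    ^±-equal false false e = H.refl

    ^±-inverse : ∀ s s' → x G.^± s' G.≈ (x G.^± s) G.⁻¹ → y H.^± s' H.≈ (y H.^± s) H.⁻¹
    ^±-inverse true  true  e = H.sym (selfInverse⇒ (G.sym e))
    ^±-inverse true  false e = H.refl
    ^±-inverse false true  e = H.sym (H.⁻¹-involutive y)
    ^±-inverse false false e =
      H.trans (selfInverse⇒ (G.trans e (G.⁻¹-involutive x))) (H.sym (H.⁻¹-involutive y))

  module _ (m : ℕ) where
    private
      module BG = Blocks G m
      module BH = Blocks H m

    InS-transfer : ∀ {u : Tuple G m} {v : Tuple H m}
      → (∀ i j → u i G.≈ u j → v i H.≈ v j)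
      → (∀ i → u i G.≈ G.ε → v i H.≈ H.ε) → (∀ i → v i H.≈ H.ε → u i G.≈ G.ε)
      → InS G m u → InS H m v
    InS-transfer {u} {v} equal ε⇒ ε⇐ (z , z≉ε , k , l , vr , u≈z) = v i₀ , vᵢ₀≉ε , k , l , vr , v≈vᵢ₀
      where
        i₀ = proj₁ (BG.inBlock-witness vr)
        uᵢ₀≈z : u i₀ G.≈ z
        uᵢ₀≈z = G.trans (u≈z i₀) (BG.atom-T (proj₂ (BG.inBlock-witness vr)))
        vᵢ₀≉ε : ¬ v i₀ H.≈ H.ε
        vᵢ₀≉ε vᵢ₀≈ε = z≉ε (G.trans (G.sym uᵢ₀≈z) (ε⇐ i₀ vᵢ₀≈ε))
        coordinate : ∀ {i} β → u i G.≈ G.atom z β → v i H.≈ H.atom (v i₀) β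
        coordinate true  uᵢ≈z = equal _ _ (G.trans uᵢ≈z (G.sym uᵢ₀≈z))
        coordinate false uᵢ≈ε = ε⇒ _ uᵢ≈ε
        v≈vᵢ₀ : _≈ₜ_ H m v (block H m (v i₀) k l)
        v≈vᵢ₀ i = coordinate (inBlock G m k l i) (u≈z i)

module AdjacencyTransfer {c ℓ c' ℓ' : Level} (G : Group c ℓ) (H : Group c' ℓ') (m : ℕ) where
  open Transfer G H using (module G; module H; quotient-transfer; InS-transfer)
  private
    module T⁻¹ = Transfer H G
    module BG = Blocks G m
    module BH = Blocks H m

  Adj-block-transfer : ∀ {a a' b b' k l k' l'}
    → ¬ a G.≈ G.ε → ¬ a' G.≈ G.ε → ¬ b H.≈ H.ε → ¬ b' H.≈ H.ε
    → (a' G.≈ a) ⇔ (b' H.≈ b) → (a' G.≈ a G.⁻¹) ⇔ (b' H.≈ b H.⁻¹)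
    → Adj G m (block G m a k l) (block G m a' k' l') → Adj H m (block H m b k l) (block H m b' k' l')
  Adj-block-transfer {a} {a'} {b} {b'} {k} {l} {k'} {l'} a≉ε a'≉ε b≉ε b'≉ε equal inverse adj =
    BH.InS-resp (λ i → H.sym (H.atom-quotient b b' (β i) (β' i)))
      (InS-transfer m
        (λ i j → quotient⇒ (β i) (β' i) (β j) (β' j))
        (λ i → quotient⇒ (β i) (β' i) false false)
        (λ i → quotient⇐ (β i) (β' i) false false)
        (BG.InS-resp (λ i → G.atom-quotient a a' (β i) (β' i)) adj))
    where
      β β' : Fin m → Bool
      β  i = inBlock G m k l i
      β' i = inBlock G m k' l' i
      quotient⇒ = quotient-transfer a≉ε a'≉ε (Equivalence.to equal) (Equivalence.to inverse)
      quotient⇐ = T⁻¹.quotient-transfer b≉ε b'≉ε (Equivalence.from equal) (Equivalence.from inverse)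

module Translation {c ℓ c' ℓ' : Level} (G : Group c ℓ) (H : Group c' ℓ') (m : ℕ)
  {x : Group.Carrier G} {y : Group.Carrier H}
  (x≉ε : ¬ Group._≈_ G x (Group.ε G)) (y≉ε : ¬ Group._≈_ H y (Group.ε H))
  (sameSelfInverse : (Group._≈_ G (Group._⁻¹ G x) x) ⇔ (Group._≈_ H (Group._⁻¹ H y) y)) where
  open Transfer G H using (module G; module H; atom-transfer; ^±-equal; ^±-inverse)
  open AdjacencyTransfer G H m using (Adj-block-transfer)
  private
    module T⁻¹ = Transfer H G
    module BG = Blocks G m
    module BH = Blocks H m
    selfInverse⇒ = Equivalence.to sameSelfInverse
    selfInverse⇐ = Equivalence.from sameSelfInverse

  translate : VertI G m x → VertI H m y
  translate u = BH.vertex y (BG.sign u) (BG.range u)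

  translate-cong : ∀ {u v} → _≈ₜ_ G m (proj₁ u) (proj₁ v)
    → _≈ₜ_ H m (proj₁ (translate u)) (proj₁ (translate v))
  translate-cong {u} {v} u≈v i =
    atom-transfer (G.^±≉ε (BG.sign u) x≉ε) (G.^±≉ε (BG.sign v) x≉ε)
      (^±-equal selfInverse⇒ (BG.sign v) (BG.sign u)) _ _
      (G.trans (G.sym (BG.vertex≈block u i)) (G.trans (u≈v i) (BG.vertex≈block v i)))

  translate-adj : ∀ u v → Adj G m (proj₁ u) (proj₁ v)
    → Adj H m (proj₁ (translate u)) (proj₁ (translate v))
  translate-adj u v adj =
    Adj-block-transfer {k = BG.lower u} {BG.upper u} {BG.lower v} {BG.upper v}
      (G.^±≉ε s x≉ε) (G.^±≉ε s' x≉ε) (H.^±≉ε s y≉ε) (H.^±≉ε s' y≉ε)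
      (mk⇔ (^±-equal selfInverse⇒ s s') (T⁻¹.^±-equal selfInverse⇐ s s'))
      (mk⇔ (^±-inverse selfInverse⇒ s s') (T⁻¹.^±-inverse selfInverse⇐ s s'))
      (BG.Adj-resp (BG.vertex≈block u) (BG.vertex≈block v) adj)
    where
      s s' : Bool
      s  = BG.sign u
      s' = BG.sign v

sameSelfInverse⇒IsoI : ∀ {c ℓ c' ℓ'} {G : Group c ℓ} {H : Group c' ℓ'} m {x y}
  → ¬ Group._≈_ G x (Group.ε G) → ¬ Group._≈_ H y (Group.ε H)
  → (Group._≈_ G (Group._⁻¹ G x) x) ⇔ (Group._≈_ H (Group._⁻¹ H y) y)
  → IsoI m G x H y
sameSelfInverse⇒IsoI {G = G} {H} m x≉ε y≉ε sameSelfInverse = record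
  { to        = To.translate
  ; from      = From.translate
  ; to-cong   = λ {u} {v} → To.translate-cong {u} {v}
  ; from-cong = λ {u} {v} → From.translate-cong {u} {v}
  ; from∘to   = from∘to
  ; to∘from   = to∘from
  ; adj-to    = To.translate-adj
  ; adj-from  = λ u v adj →
      Blocks.Adj-resp G m (from∘to u) (from∘to v) (From.translate-adj (To.translate u) (To.translate v) adj)
  }
  where
    module To   = Translation G H m x≉ε y≉ε sameSelfInverse
    module From = Translation H G m y≉ε x≉ε
      (mk⇔ (Equivalence.from sameSelfInverse) (Equivalence.to sameSelfInverse))

    from∘to : ∀ u → _≈ₜ_ G m (proj₁ (From.translate (To.translate u))) (proj₁ u)
    from∘to (_ , _ , _ , _ , inj₁ t≈block) i = Group.sym G (t≈block i)
    from∘to (_ , _ , _ , _ , inj₂ t≈block) i = Group.sym G (t≈block i)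

    to∘from : ∀ v → _≈ₜ_ H m (proj₁ (To.translate (From.translate v))) (proj₁ v)
    to∘from (_ , _ , _ , _ , inj₁ t≈block) i = Group.sym H (t≈block i)
    to∘from (_ , _ , _ , _ , inj₂ t≈block) i = Group.sym H (t≈block i)

EdgesInTriangles : ∀ {c ℓ} (G : Group c ℓ) (m : ℕ) → Group.Carrier G → Set (c ⊔ ℓ)
EdgesInTriangles G m x = ∀ (u v : VertI G m x) → Adj G m (proj₁ u) (proj₁ v)
  → ∃ λ (w : VertI G m x) → Adj G m (proj₁ u) (proj₁ w) × Adj G m (proj₁ v) (proj₁ w)

IsoI-sym : ∀ {c ℓ c' ℓ'} {m} {G : Group c ℓ} {H : Group c' ℓ'} {x y}
  → IsoI m G x H y → IsoI m H y G x
IsoI-sym {m = m} {G} {H} iso = record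
  { to        = from
  ; from      = to
  ; to-cong   = λ {u} {v} → from-cong {u} {v}
  ; from-cong = λ {u} {v} → to-cong {u} {v}
  ; from∘to   = to∘from
  ; to∘from   = from∘to
  ; adj-to    = λ u v adj → adj-from (from u) (from v)
      (Adj-resp (λ i → Group.sym H (to∘from u i)) (λ i → Group.sym H (to∘from v i)) adj)
  ; adj-from  = λ u v adj → Adj-resp (to∘from u) (to∘from v) (adj-to (from u) (from v) adj)
  }
  where
    open IsoI iso
    open Blocks H m using (Adj-resp)

EdgesInTriangles-transfer : ∀ {c ℓ c' ℓ'} {m} {G : Group c ℓ} {H : Group c' ℓ'} {x y}
  → IsoI m G x H y → EdgesInTriangles G m x → EdgesInTriangles H m y
EdgesInTriangles-transfer {m = m} {G} {H} iso triangles a b a~b =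
  let w , a'~w , b'~w = triangles (from a) (from b)
        (adj-from (from a) (from b)
          (Adj-resp (λ i → Group.sym H (to∘from a i)) (λ i → Group.sym H (to∘from b i)) a~b))
  in  to w
    , Adj-resp (to∘from a) (λ _ → Group.refl H) (adj-to (from a) w a'~w)
    , Adj-resp (to∘from b) (λ _ → Group.refl H) (adj-to (from b) w b'~w)
  where
    open IsoI iso
    open Blocks H m using (Adj-resp)

selfInverse⇒EdgesInTriangles : ∀ {c ℓ} (G : Group c ℓ) m {x}
  → ¬ Group._≈_ G x (Group.ε G) → Group._≈_ G (Group._⁻¹ G x) x → EdgesInTriangles G m x
selfInverse⇒EdgesInTriangles G m {x} x≉ε x⁻¹≈x u v u~v =
  let p , q , vr , u~w , v~w = selfInverse-edge-triangle x≉ε x⁻¹≈x (range u) (range v)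
                                 (Adj-resp (≈block u) (≈block v) u~v)
  in  vertex x true vr
    , Adj-resp (λ i → sym (≈block u i)) (λ _ → refl) u~w
    , Adj-resp (λ i → sym (≈block v i)) (λ _ → refl) v~w
  where
    open Group G
    open Coordinates G
    open Blocks G m

    ≈block : ∀ w → _≈ₜ_ G m (proj₁ w) (block G m x (lower w) (upper w))
    ≈block w i = trans (vertex≈block w i) (atom-cong _ (^±-selfInverse x⁻¹≈x (sign w)))

¬selfInverse⇒¬EdgesInTriangles : ∀ {c ℓ} (H : Group c ℓ) n {y}
  → ¬ Group._≈_ H y (Group.ε H) → ¬ Group._≈_ H (Group._⁻¹ H y) y → ¬ EdgesInTriangles H (suc n) y
¬selfInverse⇒¬EdgesInTriangles H n {y} y≉ε y⁻¹≉y triangles =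
  let w , U~W , V~W = triangles U V U~V
  in  noCommonNeighbour (sign w) (range w)
        (InS-resp (λ _ → atom-quotient y _ _ _) (Adj-resp (λ _ → refl) (vertex≈block w) U~W))
        (InS-resp (λ _ → atom-quotient (y ⁻¹) _ _ _) (Adj-resp (λ _ → refl) (vertex≈block w) V~W))
  where
    open Group H
    open GroupProperties H
    open Coordinates H
    open Blocks H (suc n)

    first : ValidRange H (suc n) 1 2
    first = s≤s z≤n , s≤s (s≤s z≤n) , s≤s (s≤s z≤n)

    U V : VertI H (suc n) y
    U = vertex y true first
    V = vertex y false first

    y⁻¹∙y⁻¹≉ε : ¬ y ⁻¹ ∙ y ⁻¹ ≈ ε
    y⁻¹∙y⁻¹≉ε e = y⁻¹≉y (trans (sym (square≈ε⇒selfInverse e)) (⁻¹-involutive y))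

    U~V : Adj H (suc n) (proj₁ U) (proj₁ V)
    U~V = y ⁻¹ ∙ y ⁻¹ , y⁻¹∙y⁻¹≉ε , 1 , 2 , first , λ i →
      trans (atom-quotient y (y ⁻¹) _ _) (quotient-diagonal y (y ⁻¹) (inBlock H (suc n) 1 2 i))

    -- The quotients of a common neighbour c_[k,l) by U and by V agree off the first
    -- coordinate, where they are c ∙ y⁻¹ and c ∙ y respectively.
    quotientBy : Carrier → Bool → ℕ → ℕ → Tuple H (suc n)
    quotientBy a s k l i = quotient a (y ^± s) (inBlock H (suc n) 1 2 i) (inBlock H (suc n) k l i)

    noCommonNeighbour : ∀ s {k l} → ValidRange H (suc n) k l
      → InS H (suc n) (quotientBy y s k l) → InS H (suc n) (quotientBy (y ⁻¹) s k l) → ⊥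
    noCommonNeighbour s {suc (suc k)} {l} vr U∈S V∈S with inBlock-witness vr
    ... | suc j , Tⱼ = y⁻¹≉y (trans y⁻¹≈c (trans (sym y⁻¹⁻¹≈c) (⁻¹-involutive y)))
      where
        c≉ε : ¬ atom (y ^± s) (inBlock H (suc n) (suc (suc k)) l (suc j)) ≈ ε
        c≉ε e = ^±≉ε s y≉ε (trans (sym (atom-T Tⱼ)) e)
        y⁻¹≈c   = InS-constant U∈S {zero} {suc j} (^±≉ε false y≉ε) c≉ε
        y⁻¹⁻¹≈c = InS-constant V∈S {zero} {suc j} (^±≉ε false (^±≉ε false y≉ε)) c≉ε
    noCommonNeighbour _ {suc zero} {suc zero} (_ , s≤s () , _)
    noCommonNeighbour true {suc zero} {suc (suc l)} vr U∈S V∈S with InS-support U∈S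
    ... | zero  , U₀≉ε = U₀≉ε (inverseʳ y)
    ... | suc j , Uⱼ≉ε = y≉ε (⁻¹≈ε⇒≈ε (⁻¹≈ε⇒≈ε (identityʳ-unique y _ (trans y∙y⁻¹⁻¹≈Uⱼ Uⱼ≈y))))
      where
        Uⱼ≈y = ≈atom⇒≈ _ refl Uⱼ≉ε
        y∙y⁻¹⁻¹≈Uⱼ = InS-constant V∈S {zero} {suc j} (λ e → y⁻¹≉y (sym (x∙y⁻¹≈ε⇒x≈y y (y ⁻¹) e))) Uⱼ≉ε
    noCommonNeighbour false {suc zero} {suc (suc l)} vr U∈S V∈S with InS-support V∈S
    ... | zero  , V₀≉ε = V₀≉ε (inverseʳ (y ⁻¹))
    ... | suc j , Vⱼ≉ε = y≉ε (⁻¹≈ε⇒≈ε (identityʳ-unique (y ⁻¹) _ (trans y⁻¹∙y⁻¹≈Vⱼ Vⱼ≈y⁻¹)))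
      where
        Vⱼ≈y⁻¹ = ≈atom⇒≈ _ refl Vⱼ≉ε
        y⁻¹∙y⁻¹≈Vⱼ = InS-constant U∈S {zero} {suc j} y⁻¹∙y⁻¹≉ε Vⱼ≉ε

lemma4p2 : {c ℓ c' ℓ' : Level} (m : ℕ) → 1 < m
    → (G : Group c ℓ) (H : Group c' ℓ')
    → IsFinite G → IsFinite H → NonTrivial G → NonTrivial H
    → (x : Group.Carrier G) → ¬ (Group._≈_ G x (Group.ε G))
    → (y : Group.Carrier H) → ¬ (Group._≈_ H y (Group.ε H))
    → IsoI m G x H y
      ⇔ ((IsOrder G x 2 × IsOrder H y 2) ⊎ (¬ IsOrder G x 2 × ¬ IsOrder H y 2))
lemma4p2 (suc n) _ G H finiteG finiteH _ _ x x≉ε y y≉ε = mk⇔ orders isomorphic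
  where
    module CG = Coordinates G
    module CH = Coordinates H
    orderG = CG.isOrder2⇔selfInverse x≉ε
    orderH = CH.isOrder2⇔selfInverse y≉ε

    orders : IsoI (suc n) G x H y → _
    orders iso with CG.selfInverse? finiteG x | CH.selfInverse? finiteH y
    ... | yes x⁻¹≈x | yes y⁻¹≈y = inj₁ (Equivalence.from orderG x⁻¹≈x , Equivalence.from orderH y⁻¹≈y)
    ... | no  x⁻¹≉x | no  y⁻¹≉y =
          inj₂ ((λ o → x⁻¹≉x (Equivalence.to orderG o)) , (λ o → y⁻¹≉y (Equivalence.to orderH o)))
    ... | yes x⁻¹≈x | no  y⁻¹≉y = ⊥-elim (¬selfInverse⇒¬EdgesInTriangles H n y≉ε y⁻¹≉y
          (EdgesInTriangles-transfer iso (selfInverse⇒EdgesInTriangles G _ x≉ε x⁻¹≈x)))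
    ... | no  x⁻¹≉x | yes y⁻¹≈y = ⊥-elim (¬selfInverse⇒¬EdgesInTriangles G n x≉ε x⁻¹≉x
          (EdgesInTriangles-transfer (IsoI-sym iso) (selfInverse⇒EdgesInTriangles H _ y≉ε y⁻¹≈y)))

    isomorphic : _ → IsoI (suc n) G x H y
    isomorphic (inj₁ (ox , oy)) = sameSelfInverse⇒IsoI _ x≉ε y≉ε
      (mk⇔ (λ _ → Equivalence.to orderH oy) (λ _ → Equivalence.to orderG ox))
    isomorphic (inj₂ (¬ox , ¬oy)) = sameSelfInverse⇒IsoI _ x≉ε y≉ε
      (mk⇔ (λ x⁻¹≈x → ⊥-elim (¬ox (Equivalence.from orderG x⁻¹≈x)))
           (λ y⁻¹≈y → ⊥-elim (¬oy (Equivalence.from orderH y⁻¹≈y))))
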